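{- Let $G=(V,E)$ be a graph, let $T_1,T_2$ be spanning trees of $G$, and let $\sigma:E(T_1)\to E(T_2)$ be a tree-mapping function from $T_1$ to $T_2$. Let $e_1,e_2,e_3\in E(T_1)$ be three edges all incident to a common vertex $v$. Then $\{\sigma(e_1),\sigma(e_2),\sigma(e_3)\}$ contains at least two distinct elements.
   Context: Graphs may have parallel edges. For spanning trees $T_1,T_2$ of $G$, a tree-mapping function from $T_1$ to $T_2$ is a function $\sigma:E(T_1)\to E(T_2)$ such that for every $e\in E(T_1)$, both $T_1-e+\sigma(e)$ and $T_2-\sigma(e)+e$ are spanning trees of $G$. -}

module Defs where

open import Data.Nat using (ℕ)
open import Data.Fin using (Fin)
open import Data.Fin.Subset using (Subset; _∈_; _∉_; _-_; _∪_; ⁅_⁆)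
open import Data.Product using (_×_; _,_; proj₁; proj₂)
open import Relation.Binary.PropositionalEquality using (_≡_)
open import Relation.Nullary using (¬_)

-- A (multi)graph with vertex set Fin n and edge set Fin m; each edge has
-- two (unordered) endpoints. Parallel edges (and loops) are allowed.
record Graph : Set where
  field
    n   : ℕ
    m   : ℕ
    ends : Fin m → Fin n × Fin n

open Graph public

EdgeSet : Graph → Set
EdgeSet G = Subset (m G)

data Walk (G : Graph) (S : EdgeSet G) : Fin (n G) → Fin (n G) → Set where
  here : ∀ {u} → Walk G S u u
  fwd  : ∀ {w} (e : Fin (m G)) → e ∈ S →
         Walk G S (proj₂ (ends G e)) w → Walk G S (proj₁ (ends G e)) w
  bwd  : ∀ {w} (e : Fin (m G)) → e ∈ S →
         Walk G S (proj₁ (ends G e)) w → Walk G S (proj₂ (ends G e)) w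

Connected : (G : Graph) → EdgeSet G → Set
Connected G S = ∀ u w → Walk G S u w

-- The spanning subgraph (V, S) has no cycle: every edge of S is a bridge,
-- i.e. its endpoints are not joined by a walk avoiding it.
-- (Excludes loops and pairs of parallel edges, which form cycles.)
Acyclic : (G : Graph) → EdgeSet G → Set
Acyclic G S = ∀ e → e ∈ S → ¬ Walk G (S - e) (proj₁ (ends G e)) (proj₂ (ends G e))

SpanningTree : (G : Graph) → EdgeSet G → Set
SpanningTree G S = Connected G S × Acyclic G S

-- σ : E(T₁) → E(T₂) is a tree-mapping function from T₁ to T₂
-- (σ is given as a function on all edges; only its values on E(T₁) matter).
TreeMapping : (G : Graph) → EdgeSet G → EdgeSet G → (Fin (m G) → Fin (m G)) → Set
TreeMapping G T₁ T₂ σ =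
  ∀ e → e ∈ T₁ →
    σ e ∈ T₂
    × SpanningTree G ((T₁ - e) ∪ ⁅ σ e ⁆)
    × SpanningTree G ((T₂ - σ e) ∪ ⁅ e ⁆)

IncidentTo : (G : Graph) → Fin (m G) → Fin (n G) → Set
IncidentTo G e v = (proj₁ (ends G e) ≡ v) Data.Sum.⊎ (proj₂ (ends G e) ≡ v)
  where import Data.Sum

-- Removing an edge e = vw of T₁ splits T₁ into the side of v and the far side
-- of e. Since T₁ - e + σ(e) is connected, σ(e) must have an endpoint on the
-- far side of e. For distinct edges at v the far sides are disjoint, as a
-- common vertex would close a cycle through v. So three edges at v with the
-- same image would give three disjoint sets each containing one of the two
-- endpoints of that image.
module Submission where

open import Defs
open import Data.Fin using (Fin; _≟_)
open import Data.Fin.Subset using (Subset; _∈_; _∉_; _-_; _─_; _∪_; ⁅_⁆; _⊆_; inside; outside)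
open import Data.Fin.Subset.Properties using (x∈p∪q⁻; p─q⊆p; x∈p∧x≢y⇒x∈p-y; p─x─y≡p─y─x)
open import Data.Vec using (_∷_; here; there)
open import Data.Product using (_,_; proj₁; proj₂)
open import Data.Sum using (_⊎_; inj₁; inj₂)
import Data.Sum as Sum
open import Data.Empty using (⊥; ⊥-elim)
open import Function using (_∘_)
open import Relation.Nullary using (¬_; yes; no)
open import Relation.Binary.PropositionalEquality using (_≡_; _≢_; refl; sym; subst)

x∈p─q⇒x∉q : ∀ {k} {p q : Subset k} {x : Fin k} → x ∈ p ─ q → x ∉ q
x∈p─q⇒x∉q {p = inside ∷ _}  {q = outside ∷ _} here ()
x∈p─q⇒x∉q {p = _ ∷ _}       {q = _ ∷ _}       (there x∈p─q) (there x∈q) = x∈p─q⇒x∉q x∈p─q x∈q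

p∪⁅y⁆-y⊆p : ∀ {k} (p : Subset k) (y : Fin k) → (p ∪ ⁅ y ⁆) - y ⊆ p
p∪⁅y⁆-y⊆p p y x∈ with x∈p∪q⁻ p ⁅ y ⁆ (p─q⊆p _ _ x∈)
... | inj₁ x∈p  = x∈p
... | inj₂ x∈⁅y⁆ = ⊥-elim (x∈p─q⇒x∉q x∈ x∈⁅y⁆)

¬three-disjoint-meet-pair : ∀ {A : Set} {P Q R : A → Set} {a b : A} →
  (∀ {x} → P x → Q x → ⊥) → (∀ {x} → P x → R x → ⊥) → (∀ {x} → Q x → R x → ⊥) →
  P a ⊎ P b → Q a ⊎ Q b → R a ⊎ R b → ⊥
¬three-disjoint-meet-pair P∩Q P∩R Q∩R = go
  where
  go : _ ⊎ _ → _ ⊎ _ → _ ⊎ _ → ⊥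
  go (inj₁ pa) (inj₁ qa) _         = P∩Q pa qa
  go (inj₂ pb) (inj₂ qb) _         = P∩Q pb qb
  go (inj₁ pa) (inj₂ _)  (inj₁ ra) = P∩R pa ra
  go (inj₂ pb) (inj₁ _)  (inj₂ rb) = P∩R pb rb
  go (inj₁ _)  (inj₂ qb) (inj₂ rb) = Q∩R qb rb
  go (inj₂ _)  (inj₁ qa) (inj₁ ra) = Q∩R qa ra

module Walks (G : Graph) where

  Vertex : Set
  Vertex = Fin (n G)

  Edge : Set
  Edge = Fin (m G)

  end₁ end₂ : Edge → Vertex
  end₁ e = proj₁ (ends G e)
  end₂ e = proj₂ (ends G e)

  walk-mono : ∀ {S S′ : EdgeSet G} → S ⊆ S′ → ∀ {a b} → Walk G S a b → Walk G S′ a b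
  walk-mono S⊆S′ here          = here
  walk-mono S⊆S′ (fwd e e∈S p) = fwd e (S⊆S′ e∈S) (walk-mono S⊆S′ p)
  walk-mono S⊆S′ (bwd e e∈S p) = bwd e (S⊆S′ e∈S) (walk-mono S⊆S′ p)

  _++_ : ∀ {S a b c} → Walk G S a b → Walk G S b c → Walk G S a c
  here          ++ q = q
  fwd e e∈S p ++ q = fwd e e∈S (p ++ q)
  bwd e e∈S p ++ q = bwd e e∈S (p ++ q)

  reverse : ∀ {S a b} → Walk G S a b → Walk G S b a
  reverse here          = here
  reverse (fwd e e∈S p) = reverse p ++ bwd e e∈S here
  reverse (bwd e e∈S p) = reverse p ++ fwd e e∈S here

  ReachesEdge : EdgeSet G → Vertex → Edge → Set
  ReachesEdge S a e = Walk G S a (end₁ e) ⊎ Walk G S a (end₂ e)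

  reachesEdge-mono : ∀ {S S′ : EdgeSet G} → S ⊆ S′ → ∀ {a e} → ReachesEdge S a e → ReachesEdge S′ a e
  reachesEdge-mono S⊆S′ = Sum.map (walk-mono S⊆S′) (walk-mono S⊆S′)

  prepend : ∀ {S e a a′ b} → (∀ {w} → Walk G S a′ w → Walk G S a w) →
            Walk G S a′ b ⊎ ReachesEdge S a′ e → Walk G S a b ⊎ ReachesEdge S a e
  prepend step = Sum.map step (Sum.map step step)

  -- Cut the walk just before its first use of e.
  avoid-or-reach : ∀ {S a b} e → Walk G S a b → Walk G (S - e) a b ⊎ ReachesEdge (S - e) a e
  avoid-or-reach e here = inj₁ here
  avoid-or-reach e (fwd e′ e′∈S p) with e′ ≟ e
  ... | yes refl  = inj₂ (inj₁ here)
  ... | no  e′≢e  = prepend (fwd e′ (x∈p∧x≢y⇒x∈p-y e′∈S e′≢e)) (avoid-or-reach e p)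
  avoid-or-reach e (bwd e′ e′∈S p) with e′ ≟ e
  ... | yes refl  = inj₂ (inj₂ here)
  ... | no  e′≢e  = prepend (bwd e′ (x∈p∧x≢y⇒x∈p-y e′∈S e′≢e)) (avoid-or-reach e p)

  opposite : ∀ {e v} → IncidentTo G e v → Vertex
  opposite {e} (inj₁ _) = end₂ e
  opposite {e} (inj₂ _) = end₁ e

  opposite-walk : ∀ {S e v} (inc : IncidentTo G e v) → e ∈ S → Walk G S (opposite inc) v
  opposite-walk (inj₁ refl) e∈S = bwd _ e∈S here
  opposite-walk (inj₂ refl) e∈S = fwd _ e∈S here

  reachesEdge⇒reaches : ∀ {S e v a} (inc : IncidentTo G e v) → e ∈ S → ReachesEdge S a e → Walk G S a v
  reachesEdge⇒reaches (inj₁ refl) e∈S (inj₁ p) = p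
  reachesEdge⇒reaches (inj₁ refl) e∈S (inj₂ p) = p ++ opposite-walk (inj₁ refl) e∈S
  reachesEdge⇒reaches (inj₂ refl) e∈S (inj₁ p) = p ++ opposite-walk (inj₂ refl) e∈S
  reachesEdge⇒reaches (inj₂ refl) e∈S (inj₂ p) = p

  opposite-unreachable : ∀ {T e v} → Acyclic G T → e ∈ T → (inc : IncidentTo G e v) →
                         ¬ Walk G (T - e) (opposite inc) v
  opposite-unreachable acyclic e∈T (inj₁ refl) p = acyclic _ e∈T (reverse p)
  opposite-unreachable acyclic e∈T (inj₂ refl) p = acyclic _ e∈T p

module FarSides (G : Graph) (T : EdgeSet G) (acyclic : Acyclic G T) (v : Fin (n G)) where
  open Walks G

  FarSide : ∀ {e} → IncidentTo G e v → Vertex → Set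
  FarSide {e} inc u = Walk G (T - e) (opposite inc) u

  farSide-avoids : ∀ {eᵢ eⱼ u} → eᵢ ∈ T → eⱼ ∈ T → eᵢ ≢ eⱼ →
                   (incᵢ : IncidentTo G eᵢ v) (incⱼ : IncidentTo G eⱼ v) →
                   FarSide incᵢ u → Walk G (T - eᵢ - eⱼ) (opposite incᵢ) u
  farSide-avoids {eⱼ = eⱼ} eᵢ∈T eⱼ∈T eᵢ≢eⱼ incᵢ incⱼ p with avoid-or-reach eⱼ p
  ... | inj₁ q = q
  ... | inj₂ q = ⊥-elim (opposite-unreachable acyclic eᵢ∈T incᵢ
                   (reachesEdge⇒reaches incⱼ (x∈p∧x≢y⇒x∈p-y eⱼ∈T (eᵢ≢eⱼ ∘ sym))
                     (reachesEdge-mono (p─q⊆p _ _) q)))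

  farSides-disjoint : ∀ {eᵢ eⱼ u} → eᵢ ∈ T → eⱼ ∈ T → eᵢ ≢ eⱼ →
                      (incᵢ : IncidentTo G eᵢ v) (incⱼ : IncidentTo G eⱼ v) →
                      FarSide incᵢ u → FarSide incⱼ u → ⊥
  farSides-disjoint {eᵢ} {eⱼ} {u} eᵢ∈T eⱼ∈T eᵢ≢eⱼ incᵢ incⱼ p q =
    opposite-unreachable acyclic eᵢ∈T incᵢ
      (walk-mono (p─q⊆p _ _) (p′ ++ reverse q′) ++ opposite-walk incⱼ (x∈p∧x≢y⇒x∈p-y eⱼ∈T (eᵢ≢eⱼ ∘ sym)))
    where
    p′ : Walk G (T - eᵢ - eⱼ) (opposite incᵢ) u
    p′ = farSide-avoids eᵢ∈T eⱼ∈T eᵢ≢eⱼ incᵢ incⱼ p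
    q′ : Walk G (T - eᵢ - eⱼ) (opposite incⱼ) u
    q′ = subst (λ S → Walk G S (opposite incⱼ) u) (p─x─y≡p─y─x T eⱼ eᵢ)
           (farSide-avoids eⱼ∈T eᵢ∈T (eᵢ≢eⱼ ∘ sym) incⱼ incᵢ q)

  reconnection-meets-farSide : ∀ {e f} → e ∈ T → (inc : IncidentTo G e v) →
                               Connected G ((T - e) ∪ ⁅ f ⁆) → FarSide inc (end₁ f) ⊎ FarSide inc (end₂ f)
  reconnection-meets-farSide {e} {f} e∈T inc connected with avoid-or-reach f (connected (opposite inc) v)
  ... | inj₁ p = ⊥-elim (opposite-unreachable acyclic e∈T inc (walk-mono (p∪⁅y⁆-y⊆p (T - e) f) p))
  ... | inj₂ p = reachesEdge-mono (p∪⁅y⁆-y⊆p (T - e) f) p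

lemma4 : (G : Graph) (T₁ T₂ : EdgeSet G) (σ : Fin (m G) → Fin (m G)) →
         SpanningTree G T₁ → SpanningTree G T₂ → TreeMapping G T₁ T₂ σ →
         (v : Fin (n G)) (e₁ e₂ e₃ : Fin (m G)) →
         e₁ ∈ T₁ → e₂ ∈ T₁ → e₃ ∈ T₁ →
         e₁ ≢ e₂ → e₁ ≢ e₃ → e₂ ≢ e₃ →
         IncidentTo G e₁ v → IncidentTo G e₂ v → IncidentTo G e₃ v →
         (σ e₁ ≢ σ e₂) ⊎ (σ e₁ ≢ σ e₃) ⊎ (σ e₂ ≢ σ e₃)
lemma4 G T₁ T₂ σ (_ , acyclic) _ mapping v e₁ e₂ e₃ e₁∈ e₂∈ e₃∈ e₁≢e₂ e₁≢e₃ e₂≢e₃ inc₁ inc₂ inc₃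
  with σ e₁ ≟ σ e₂ | σ e₁ ≟ σ e₃
... | no σ₁≢σ₂ | _        = inj₁ σ₁≢σ₂
... | yes _    | no σ₁≢σ₃ = inj₂ (inj₁ σ₁≢σ₃)
... | yes σ₁≡σ₂ | yes σ₁≡σ₃ =
  ⊥-elim (¬three-disjoint-meet-pair {P = FarSide inc₁} {Q = FarSide inc₂} {R = FarSide inc₃}
            (farSides-disjoint e₁∈ e₂∈ e₁≢e₂ inc₁ inc₂)
            (farSides-disjoint e₁∈ e₃∈ e₁≢e₃ inc₁ inc₃)
            (farSides-disjoint e₂∈ e₃∈ e₂≢e₃ inc₂ inc₃)
            (σ-meets-farSide e₁∈ inc₁ refl) (σ-meets-farSide e₂∈ inc₂ (sym σ₁≡σ₂)) (σ-meets-farSide e₃∈ inc₃ (sym σ₁≡σ₃)))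
  where
  open Walks G
  open FarSides G T₁ acyclic v

  σ-meets-farSide : ∀ {e f} → e ∈ T₁ → (inc : IncidentTo G e v) → σ e ≡ f → FarSide inc (end₁ f) ⊎ FarSide inc (end₂ f)
  σ-meets-farSide e∈ inc refl = reconnection-meets-farSide e∈ inc (proj₁ (proj₁ (proj₂ (mapping _ e∈))))
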